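{- Let $k\le l$ be positive integers with $\gcd(k,l)=1$, let $n\ge 1$ and $m\ge 0$ be integers, and write $m=qn+r$ with integers $q\ge0$, $0\le r<n$. Let $x,y$ be integers with $x\ge rk$, $y\ge rl$, $qxy+r(xl+yk)\ge klnr$, such that $x+y$ is the smallest possible among all such pairs. Then $$L^{k,l}(m,n)\ge \min\bigl(nk(q+1),\; nkq+x+y\bigr).$$
   Context: $\mathcal D^{k,l}(m,n)$ denotes the set of all $nk\times nl$ matrices with nonnegative integer entries all of whose row sums equal $ml$ and all of whose column sums equal $mk$. For an $s\times t$ matrix $A$ with $s\le t$, a transversal is a set of $s$ entries of $A$, one from each row, no two in the same column; if $s>t$, the transversals of $A$ are those of its transpose. For a transversal $T$, $|T|$ is the sum of its entries. The tropical determinant is ${\rm tdet}(A)=\max_T |T|$ over all transversals $T$ of $A$. Finally $L^{k,l}(m,n)=\min_{A\in\mathcal D^{k,l}(m,n)}{\rm tdet}(A)$. -}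

module Defs where

open import Data.Nat using (ℕ; zero; suc; _+_; _*_; _≤_; _<_; _⊓_)
open import Data.Fin using (Fin)
import Data.Fin as F
open import Data.Product using (Σ; ∃; _×_; _,_)
open import Function.Definitions using (Injective)
open import Relation.Binary.PropositionalEquality using (_≡_)

sumFin : (n : ℕ) → (Fin n → ℕ) → ℕ
sumFin zero    f = 0
sumFin (suc n) f = f F.zero + sumFin n (λ i → f (F.suc i))

Matrix : ℕ → ℕ → Set
Matrix s t = Fin s → Fin t → ℕ

rowSum : ∀ {s t} → Matrix s t → Fin s → ℕ
rowSum {t = t} A i = sumFin t (λ j → A i j)

colSum : ∀ {s t} → Matrix s t → Fin t → ℕ
colSum {s = s} A j = sumFin s (λ i → A i j)

InD : (k l m n : ℕ) → Matrix (n * k) (n * l) → Set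
InD k l m n A = (∀ i → rowSum A i ≡ m * l) × (∀ j → colSum A j ≡ m * k)

-- Transversals of an s × t matrix: if s ≤ t, one entry in each row, no two in
-- the same column (an injection rows → columns); if s > t, the transversals of
-- the transpose (an injection columns → rows).
data Transversal (s t : ℕ) : Set where
  rowsT : s ≤ t → (f : Fin s → Fin t) → Injective _≡_ _≡_ f → Transversal s t
  colsT : t < s → (g : Fin t → Fin s) → Injective _≡_ _≡_ g → Transversal s t

weight : ∀ {s t} → Matrix s t → Transversal s t → ℕ
weight {s} {t} A (rowsT _ f _) = sumFin s (λ i → A i (f i))
weight {s} {t} A (colsT _ g _) = sumFin t (λ j → A (g j) j)

IsTdet : ∀ {s t} → Matrix s t → ℕ → Set
IsTdet {s} {t} A d =
  (Σ (Transversal s t) λ T → weight A T ≡ d) × (∀ T → weight A T ≤ d)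

-- L = L^{k,l}(m,n) = min_{A ∈ 𝒟^{k,l}(m,n)} tdet(A)
IsL : (k l m n : ℕ) → ℕ → Set
IsL k l m n L =
  (Σ (Matrix (n * k) (n * l)) λ A → InD k l m n A × IsTdet A L)
  × (∀ (A : Matrix (n * k) (n * l)) → InD k l m n A → ∀ d → IsTdet A d → L ≤ d)

Admissible : (k l n q r x y : ℕ) → Set
Admissible k l n q r x y =
  (r * k ≤ x) × (r * l ≤ y) × (k * l * n * r ≤ q * x * y + r * (x * l + y * k))

module Submission where

-- Let A ∈ 𝒟^{k,l}(m,n) with tdet(A) = L.  By Egerváry's theorem there is a transversal T
-- and a cover (u, v) of A (A i j ≤ u i + v j) with Σ u + Σ v ≤ |T| ≤ L.  Let a = min u,
-- b = min v and X, Y the excesses Σ (u − a), Σ (v − b).  A column (row) where v (u) is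
-- minimal gives mk ≤ nk(a + b) + X and ml ≤ nl(a + b) + Y, so Σ u + Σ v ≥ nk(a + b) + X + Y.
-- If a + b > q this is ≥ nk(q+1); if a + b < q then Y ≥ nl ≥ nk gives the same; if
-- a + b = q, double counting on the block where u = a and v = b (entries ≤ q) shows that
-- (X, Y) is admissible, whence X + Y ≥ x + y.

open import Defs
open import Data.Bool using (Bool; true; false; _∧_; _∨_; not; if_then_else_)
import Data.Bool.Properties as Boolₚ
open import Data.Empty using (⊥; ⊥-elim)
open import Data.Fin using (Fin; _≟_; punchOut; _↑ˡ_; _↑ʳ_; splitAt; fromℕ<)
import Data.Fin as Fin
open import Data.Fin.Properties
  using (all?; any?; pigeonhole; punchOut-injective; splitAt-↑ˡ; splitAt-↑ʳ; ↑ˡ-injective)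
  renaming (<⇒≢ to <⇒≢ᶠ)
open import Data.Fin.Subset.Properties using (anySubset?)
open import Data.Nat using (ℕ; zero; suc; _+_; _*_; _∸_; _≤_; _<_; _⊓_; z≤n; s≤s; _≤?_; _<?_)
import Data.Nat as ℕ
open import Data.Nat.GCD using (gcd)
open import Data.Nat.Properties hiding (_≟_)
open import Data.Nat.Tactic.RingSolver using (solve-∀)
open import Data.Product using (Σ; ∃; _×_; _,_; proj₁; proj₂)
open import Data.Sum using (_⊎_; inj₁; inj₂; [_,_]′)
open import Data.Vec using (lookup; tabulate)
open import Data.Vec.Properties using (lookup∘tabulate)
open import Function.Definitions using (Injective)
open import Relation.Binary using (tri<; tri≈; tri>)
open import Relation.Binary.PropositionalEquality
open import Relation.Nullary using (Dec; yes; no; ¬_; does; contradiction)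
open import Relation.Nullary.Decidable using (_×-dec_; dec-true)

sumFin-cong : ∀ n {f g : Fin n → ℕ} → (∀ i → f i ≡ g i) → sumFin n f ≡ sumFin n g
sumFin-cong zero    f≗g = refl
sumFin-cong (suc n) f≗g = cong₂ _+_ (f≗g Fin.zero) (sumFin-cong n (λ i → f≗g (Fin.suc i)))

sumFin-mono : ∀ n {f g : Fin n → ℕ} → (∀ i → f i ≤ g i) → sumFin n f ≤ sumFin n g
sumFin-mono zero    f≤g = z≤n
sumFin-mono (suc n) f≤g = +-mono-≤ (f≤g Fin.zero) (sumFin-mono n (λ i → f≤g (Fin.suc i)))

sumFin-+ : ∀ n (f g : Fin n → ℕ) → sumFin n (λ i → f i + g i) ≡ sumFin n f + sumFin n g
sumFin-+ zero    f g = refl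
sumFin-+ (suc n) f g =
  trans (cong (f Fin.zero + g Fin.zero +_) (sumFin-+ n (λ i → f (Fin.suc i)) (λ i → g (Fin.suc i))))
        (interchange (f Fin.zero) (g Fin.zero) _ _)
  where
  interchange : ∀ a b c d → (a + b) + (c + d) ≡ (a + c) + (b + d)
  interchange = solve-∀

sumFin-const : ∀ n c → sumFin n (λ _ → c) ≡ n * c
sumFin-const zero    c = refl
sumFin-const (suc n) c = cong (c +_) (sumFin-const n c)

sumFin-zero : ∀ n → sumFin n (λ _ → 0) ≡ 0
sumFin-zero n = trans (sumFin-const n 0) (*-zeroʳ n)

sumFin-*ˡ : ∀ n c (f : Fin n → ℕ) → sumFin n (λ i → c * f i) ≡ c * sumFin n f
sumFin-*ˡ zero    c f = sym (*-zeroʳ c)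
sumFin-*ˡ (suc n) c f =
  trans (cong (c * f Fin.zero +_) (sumFin-*ˡ n c (λ i → f (Fin.suc i))))
        (sym (*-distribˡ-+ c (f Fin.zero) _))

sumFin-*ʳ : ∀ n (f : Fin n → ℕ) c → sumFin n (λ i → f i * c) ≡ sumFin n f * c
sumFin-*ʳ n f c =
  trans (sumFin-cong n (λ i → *-comm (f i) c)) (trans (sumFin-*ˡ n c f) (*-comm c _))

sumFin-swap : ∀ s t (A : Fin s → Fin t → ℕ) →
  sumFin s (λ i → sumFin t (A i)) ≡ sumFin t (λ j → sumFin s (λ i → A i j))
sumFin-swap zero    t A = sym (sumFin-zero t)
sumFin-swap (suc s) t A =
  trans (cong (sumFin t (A Fin.zero) +_) (sumFin-swap s t (λ i → A (Fin.suc i))))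
        (sym (sumFin-+ t (A Fin.zero) _))

term≤sumFin : ∀ n (f : Fin n → ℕ) i → f i ≤ sumFin n f
term≤sumFin (suc n) f Fin.zero    = m≤m+n _ _
term≤sumFin (suc n) f (Fin.suc i) = ≤-trans (term≤sumFin n (λ j → f (Fin.suc j)) i) (m≤n+m _ _)

sumFin-excess : ∀ n (u : Fin n → ℕ) a → (∀ i → a ≤ u i) → sumFin n u ≡ n * a + sumFin n (λ i → u i ∸ a)
sumFin-excess n u a a≤u = begin
  sumFin n u                                   ≡⟨ sumFin-cong n (λ i → sym (m∸n+n≡m (a≤u i))) ⟩
  sumFin n (λ i → (u i ∸ a) + a)               ≡⟨ sumFin-+ n _ _ ⟩
  sumFin n (λ i → u i ∸ a) + sumFin n (λ _ → a) ≡⟨ cong (sumFin n (λ i → u i ∸ a) +_) (sumFin-const n a) ⟩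
  sumFin n (λ i → u i ∸ a) + n * a             ≡⟨ +-comm _ (n * a) ⟩
  n * a + sumFin n (λ i → u i ∸ a)             ∎
  where open ≡-Reasoning

sumFin-split : ∀ s e (f : Fin (s + e) → ℕ) →
  sumFin (s + e) f ≡ sumFin s (λ i → f (i ↑ˡ e)) + sumFin e (λ i → f (s ↑ʳ i))
sumFin-split zero    e f = refl
sumFin-split (suc s) e f =
  trans (cong (f Fin.zero +_) (sumFin-split s e (λ i → f (Fin.suc i)))) (sym (+-assoc (f Fin.zero) _ _))

does-true : ∀ {a} {A : Set a} (a? : Dec A) → does a? ≡ true → A
does-true (yes a) _ = a

does-false : ∀ {a} {A : Set a} (a? : Dec A) → does a? ≡ false → ¬ A
does-false (no ¬a) _ = ¬a

does-refl : ∀ {n} (i : Fin n) → does (i ≟ i) ≡ true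
does-refl i with i ≟ i
... | yes _  = refl
... | no i≢i = ⊥-elim (i≢i refl)

BSet : ℕ → Set
BSet n = Fin n → Bool

ind : Bool → ℕ
ind true  = 1
ind false = 0

card : ∀ {n} → BSet n → ℕ
card {n} P = sumFin n (λ i → ind (P i))

_⊆_ : ∀ {n} → BSet n → BSet n → Set
P ⊆ Q = ∀ i → P i ≡ true → Q i ≡ true

full : ∀ {n} → BSet n
full _ = true

⁅_⁆ : ∀ {n} → Fin n → BSet n
⁅ a ⁆ j = does (a ≟ j)

_∖_ : ∀ {n} → BSet n → BSet n → BSet n
(P ∖ Q) i = P i ∧ not (Q i)

_∪_ : ∀ {n} → BSet n → BSet n → BSet n
(P ∪ Q) i = P i ∨ Q i

∧-intro : ∀ {a b} → a ≡ true → b ≡ true → a ∧ b ≡ true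
∧-intro refl refl = refl

∧-left : ∀ a {b} → a ∧ b ≡ true → a ≡ true
∧-left true _ = refl

∧-right : ∀ a {b} → a ∧ b ≡ true → b ≡ true
∧-right true b≡true = b≡true

∖-intro : ∀ {n} (P Q : BSet n) i → P i ≡ true → Q i ≡ false → (P ∖ Q) i ≡ true
∖-intro P Q i Pi Qi rewrite Qi = ∧-intro Pi refl

∖-left : ∀ {n} (P Q : BSet n) i → (P ∖ Q) i ≡ true → P i ≡ true
∖-left P Q i = ∧-left (P i)

∖-elim : ∀ {n} (P Q : BSet n) i → (P ∖ Q) i ≡ true → Q i ≡ true → ⊥
∖-elim P Q i PQi Qi rewrite Qi = contradiction (∧-right (P i) PQi) λ ()

⁅⁆⊆ : ∀ {n} {P : BSet n} {a} → P a ≡ true → ⁅ a ⁆ ⊆ P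
⁅⁆⊆ {P = P} {a} Pa j e = subst (λ j → P j ≡ true) (does-true (a ≟ j) e) Pa

⊆? : ∀ {n} (P Q : BSet n) → Dec (P ⊆ Q)
⊆? P Q = all? (λ i → implies? (P i) (Q i))
  where
  implies? : (a b : Bool) → Dec (a ≡ true → b ≡ true)
  implies? false b     = yes (λ ())
  implies? true  true  = yes (λ _ → refl)
  implies? true  false = no (λ h → contradiction (h refl) λ ())

sumFin-select : ∀ n (a : Fin n) (g : Fin n → ℕ) → sumFin n (λ j → ind (⁅ a ⁆ j) * g j) ≡ g a
sumFin-select (suc n) Fin.zero    g =
  trans (cong₂ _+_ (+-identityʳ (g Fin.zero)) (sumFin-zero n)) (+-identityʳ _)
sumFin-select (suc n) (Fin.suc a) g = sumFin-select n a (λ j → g (Fin.suc j))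

card-full : ∀ n → card (full {n}) ≡ n
card-full n = trans (sumFin-const n 1) (*-identityʳ n)

card-⁅⁆ : ∀ {n} (a : Fin n) → card ⁅ a ⁆ ≡ 1
card-⁅⁆ {n} a = trans (sumFin-cong n (λ j → sym (*-identityʳ _))) (sumFin-select n a (λ _ → 1))

card-empty : ∀ {n} (P : BSet n) → (∀ i → P i ≡ false) → card P ≡ 0
card-empty {n} P empty = trans (sumFin-cong n (λ i → cong ind (empty i))) (sumFin-zero n)

card-pos : ∀ {n} (P : BSet n) i → P i ≡ true → 1 ≤ card P
card-pos {n} P i Pi = ≤-trans (≤-reflexive (cong ind (sym Pi))) (term≤sumFin n (λ i → ind (P i)) i)

card-cong : ∀ {n} {P Q : BSet n} → (∀ i → P i ≡ Q i) → card P ≡ card Q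
card-cong {n} P≗Q = sumFin-cong n (λ i → cong ind (P≗Q i))

card-mono : ∀ {n} {P Q : BSet n} → P ⊆ Q → card P ≤ card Q
card-mono {n} {P} {Q} P⊆Q = sumFin-mono n (λ i → pointwise (P i) (Q i) (P⊆Q i))
  where
  pointwise : ∀ a b → (a ≡ true → b ≡ true) → ind a ≤ ind b
  pointwise false b _   = z≤n
  pointwise true  b a⇒b rewrite a⇒b refl = ≤-refl

card-∖ : ∀ {n} (R S : BSet n) → S ⊆ R → card R ≡ card S + card (R ∖ S)
card-∖ {n} R S S⊆R = trans (sumFin-cong n (λ i → pointwise (R i) (S i) (S⊆R i))) (sumFin-+ n _ _)
  where
  pointwise : ∀ r s → (s ≡ true → r ≡ true) → ind r ≡ ind s + ind (r ∧ not s)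
  pointwise r false _   rewrite Boolₚ.∧-identityʳ r = refl
  pointwise r true  s⇒r rewrite s⇒r refl = refl

card-remove : ∀ {n} {R : BSet n} {a} → R a ≡ true → card R ≡ suc (card (R ∖ ⁅ a ⁆))
card-remove {R = R} {a} Ra = trans (card-∖ R ⁅ a ⁆ (⁅⁆⊆ Ra)) (cong (_+ card (R ∖ ⁅ a ⁆)) (card-⁅⁆ a))

card-∪-disjoint : ∀ {n} (P Q : BSet n) → (∀ i → P i ≡ true → Q i ≡ false) →
  card (P ∪ Q) ≡ card P + card Q
card-∪-disjoint {n} P Q disjoint =
  trans (sumFin-cong n (λ i → pointwise (P i) (Q i) (disjoint i))) (sumFin-+ n _ _)
  where
  pointwise : ∀ a b → (a ≡ true → b ≡ false) → ind (a ∨ b) ≡ ind a + ind b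
  pointwise false b _   = refl
  pointwise true  b a⇒¬b rewrite a⇒¬b refl = refl

card-cover : ∀ {n} (P Q Q′ : BSet n) → (∀ i → P i ≡ true → Q i ≡ false → Q′ i ≡ true) →
  card P ≤ card Q′ + card Q
card-cover {n} P Q Q′ covered =
  ≤-trans (sumFin-mono n (λ i → pointwise (P i) (Q′ i) (Q i) (covered i))) (≤-reflexive (sumFin-+ n _ _))
  where
  pointwise : ∀ a b c → (a ≡ true → c ≡ false → b ≡ true) → ind a ≤ ind b + ind c
  pointwise false b c     _ = z≤n
  pointwise true  b true  _ = m≤n+m 1 (ind b)
  pointwise true  b false h rewrite h refl refl = ≤-refl

anyB : ∀ {n} → BSet n → Bool
anyB {zero}  P = false
anyB {suc n} P = P Fin.zero ∨ anyB (λ i → P (Fin.suc i))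

anyB-elim : ∀ {n} (P : BSet n) → anyB P ≡ true → ∃ λ i → P i ≡ true
anyB-elim {suc n} P h with P Fin.zero in P0
... | true  = Fin.zero , P0
... | false with anyB-elim (λ i → P (Fin.suc i)) h
...   | i , Pi = Fin.suc i , Pi

anyB-intro : ∀ {n} (P : BSet n) i → P i ≡ true → anyB P ≡ true
anyB-intro P Fin.zero    Pi rewrite Pi = refl
anyB-intro P (Fin.suc i) Pi rewrite anyB-intro (λ i → P (Fin.suc i)) i Pi = Boolₚ.∨-zeroʳ (P Fin.zero)

anyB-cong : ∀ {n} {P Q : BSet n} → (∀ i → P i ≡ Q i) → anyB P ≡ anyB Q
anyB-cong {zero}  P≗Q = refl
anyB-cong {suc n} P≗Q = cong₂ _∨_ (P≗Q Fin.zero) (anyB-cong (λ i → P≗Q (Fin.suc i)))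

-- Hall's theorem for the bipartite graph G between rows Fin s and columns Fin t
-- (default is a dummy column used only when there are no rows to match).
module Hall {s t : ℕ} (G : Fin s → Fin t → Bool) (default : Fin t) where

  Nbr : BSet s → BSet t → BSet t
  Nbr S C j = C j ∧ anyB (λ i → S i ∧ G i j)

  Matching : BSet s → BSet t → Set
  Matching R C = Σ (Fin s → Fin t) λ f →
    (∀ i → R i ≡ true → (G i (f i) ≡ true) × (C (f i) ≡ true)) ×
    (∀ i i′ → R i ≡ true → R i′ ≡ true → f i ≡ f i′ → i ≡ i′)

  Violator : BSet s → BSet t → Set
  Violator R C = Σ (BSet s) λ S → S ⊆ R × card (Nbr S C) < card S

  Tight : BSet s → BSet t → BSet s → Set
  Tight R C S = S ⊆ R × 1 ≤ card S × card S < card R × card (Nbr S C) ≤ card S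

  tight? : ∀ R C S → Dec (Tight R C S)
  tight? R C S = ⊆? S R ×-dec 1 ≤? card S ×-dec card S <? card R ×-dec card (Nbr S C) ≤? card S

  tight-resp : ∀ R C {S S′} → (∀ i → S i ≡ S′ i) → Tight R C S → Tight R C S′
  tight-resp R C {S} {S′} S≗S′ (S⊆R , nonempty , proper , few) =
    (λ i e → S⊆R i (trans (S≗S′ i) e)) ,
    subst (1 ≤_) |S|≡ nonempty , subst (_< card R) |S|≡ proper , subst₂ _≤_ |N|≡ |S|≡ few
    where
    |S|≡ : card S ≡ card S′
    |S|≡ = card-cong S≗S′
    |N|≡ : card (Nbr S C) ≡ card (Nbr S′ C)
    |N|≡ = card-cong (λ j → cong (C j ∧_) (anyB-cong (λ i → cong (_∧ G i j) (S≗S′ i))))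

  Nbr⊆ : ∀ S C → Nbr S C ⊆ C
  Nbr⊆ S C j = ∧-left (C j)

  emptyMatching : ∀ {R} C → (∀ i → R i ≡ true → ⊥) → Matching R C
  emptyMatching C none =
    (λ _ → default) , (λ i Ri → ⊥-elim (none i Ri)) , (λ i _ Ri _ _ → ⊥-elim (none i Ri))

  -- A violator of S inside N_C(S) is a violator of R in C, since N_C(T) ⊆ N_C(S) for T ⊆ S.
  violator-inside : ∀ {R S C} → S ⊆ R → Violator S (Nbr S C) → Violator R C
  violator-inside {R} {S} {C} S⊆R (T , T⊆S , few) =
    T , (λ i Ti → S⊆R i (T⊆S i Ti)) , ≤-<-trans (card-mono N⊆) few
    where
    N⊆ : Nbr T C ⊆ Nbr T (Nbr S C)
    N⊆ j j∈N with anyB-elim (λ i → T i ∧ G i j) (∧-right (C j) j∈N)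
    ... | i , TGij = ∧-intro (∧-intro (∧-left (C j) j∈N) S-adj) (anyB-intro _ i TGij)
      where
      S-adj : anyB (λ i → S i ∧ G i j) ≡ true
      S-adj = anyB-intro _ i (∧-intro (T⊆S i (∧-left (T i) TGij)) (∧-right (T i) TGij))

  violator-outside : ∀ {R S C} → S ⊆ R → card (Nbr S C) ≤ card S →
    Violator (R ∖ S) (C ∖ Nbr S C) → Violator R C
  violator-outside {R} {S} {C} S⊆R fewS (T , T⊆R∖S , fewT) = T ∪ S , T∪S⊆R , (begin-strict
    card (Nbr (T ∪ S) C)                          ≤⟨ card-cover _ _ _ covered ⟩
    card (Nbr T (C ∖ Nbr S C)) + card (Nbr S C)   <⟨ +-mono-<-≤ fewT fewS ⟩
    card T + card S                               ≡⟨ card-∪-disjoint T S disjoint ⟨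
    card (T ∪ S)                                  ∎)
    where
    open ≤-Reasoning
    disjoint : ∀ i → T i ≡ true → S i ≡ false
    disjoint i Ti with S i | ∧-right (R i) (T⊆R∖S i Ti)
    ... | false | _ = refl
    T∪S⊆R : (T ∪ S) ⊆ R
    T∪S⊆R i e with T i in Ti
    ... | true  = ∖-left R S i (T⊆R∖S i Ti)
    ... | false = S⊆R i e
    covered : ∀ j → Nbr (T ∪ S) C j ≡ true → Nbr S C j ≡ false → Nbr T (C ∖ Nbr S C) j ≡ true
    covered j e ¬NSj with anyB-elim (λ i → (T ∪ S) i ∧ G i j) (∧-right (C j) e)
    ... | i , hit with T i in Ti | S i in Si
    ... | true  | _     = ∧-intro (∖-intro C (Nbr S C) j (∧-left (C j) e) ¬NSj) (anyB-intro _ i (∧-intro Ti hit))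
    ... | false | true  = contradiction (trans (sym ¬NSj) NSj) λ ()
      where
      NSj : Nbr S C j ≡ true
      NSj = ∧-intro (∧-left (C j) e) (anyB-intro _ i (∧-intro Si hit))
    ... | false | false = contradiction hit λ ()

  -- Matchings of S into C₁ ⊆ C and of R ∖ S into C ∖ C₁ use disjoint columns, so
  -- together they match R into C.
  glue : ∀ {R S C C₁} → C₁ ⊆ C → Matching S C₁ → Matching (R ∖ S) (C ∖ C₁) → Matching R C
  glue {R} {S} {C} {C₁} C₁⊆C (f₁ , ok₁ , inj₁′) (f₂ , ok₂ , inj₂′) = f , ok , inj
    where
    f : Fin s → Fin t
    f i = if S i then f₁ i else f₂ i
    rest : ∀ {i} → R i ≡ true → S i ≡ false → (R ∖ S) i ≡ true
    rest {i} Ri ¬Si = ∖-intro R S i Ri ¬Si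
    apart : ∀ i i′ → S i ≡ true → R i′ ≡ true → S i′ ≡ false → f₁ i ≡ f₂ i′ → ⊥
    apart i i′ Si Ri′ ¬Si′ e =
      ∖-elim C C₁ (f₂ i′) (proj₂ (ok₂ i′ (rest Ri′ ¬Si′)))
        (subst (λ j → C₁ j ≡ true) e (proj₂ (ok₁ i Si)))
    ok : ∀ i → R i ≡ true → (G i (f i) ≡ true) × (C (f i) ≡ true)
    ok i Ri with S i in Si
    ... | true  = proj₁ (ok₁ i Si) , C₁⊆C _ (proj₂ (ok₁ i Si))
    ... | false = proj₁ (ok₂ i (rest Ri Si)) , ∖-left C C₁ _ (proj₂ (ok₂ i (rest Ri Si)))
    inj : ∀ i i′ → R i ≡ true → R i′ ≡ true → f i ≡ f i′ → i ≡ i′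
    inj i i′ Ri Ri′ e with S i in Si | S i′ in Si′
    ... | true  | true  = inj₁′ i i′ Si Si′ e
    ... | false | false = inj₂′ i i′ (rest Ri Si) (rest Ri′ Si′) e
    ... | true  | false = ⊥-elim (apart i i′ Si Ri′ Si′ e)
    ... | false | true  = ⊥-elim (apart i′ i Si′ Ri Si (sym e))

  combine : ∀ {R S C} → S ⊆ R → card (Nbr S C) ≤ card S →
    Matching S (Nbr S C) ⊎ Violator S (Nbr S C) →
    Matching (R ∖ S) (C ∖ Nbr S C) ⊎ Violator (R ∖ S) (C ∖ Nbr S C) →
    Matching R C ⊎ Violator R C
  combine             S⊆R _   (inj₂ v₁) _         = inj₂ (violator-inside S⊆R v₁)
  combine             S⊆R few (inj₁ _)  (inj₂ v₂) = inj₂ (violator-outside S⊆R few v₂)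
  combine {S = S} {C} _   _   (inj₁ m₁) (inj₁ m₂) = inj₁ (glue (Nbr⊆ S C) m₁ m₂)

  isolatedRow : ∀ {R C} i₀ → R i₀ ≡ true → ¬ (∃ λ j → G i₀ j ∧ C j ≡ true) → Violator R C
  isolatedRow {R} {C} i₀ Ri₀ isolated = ⁅ i₀ ⁆ , ⁅⁆⊆ Ri₀ , few
    where
    noNbr : ∀ j → Nbr ⁅ i₀ ⁆ C j ≡ false
    noNbr j with Nbr ⁅ i₀ ⁆ C j in e
    ... | false = refl
    ... | true with anyB-elim (λ i → ⁅ i₀ ⁆ i ∧ G i j) (∧-right (C j) e)
    ...   | i , hit with does-true (i₀ ≟ i) (∧-left (⁅ i₀ ⁆ i) hit)
    ...     | refl = ⊥-elim (isolated (j , ∧-intro (∧-right (⁅ i₀ ⁆ i₀) hit) (∧-left (C j) e)))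
    few : card (Nbr ⁅ i₀ ⁆ C) < card ⁅ i₀ ⁆
    few rewrite card-empty (Nbr ⁅ i₀ ⁆ C) noNbr | card-⁅⁆ i₀ = s≤s z≤n

  extend : ∀ {R C} i₀ j₀ → G i₀ j₀ ∧ C j₀ ≡ true →
    Matching (R ∖ ⁅ i₀ ⁆) (C ∖ ⁅ j₀ ⁆) → Matching R C
  extend {R} {C} i₀ j₀ edge (f′ , ok′ , inj′) = f , ok , inj
    where
    f : Fin s → Fin t
    f i = if ⁅ i₀ ⁆ i then j₀ else f′ i
    rest : ∀ {i} → R i ≡ true → ⁅ i₀ ⁆ i ≡ false → (R ∖ ⁅ i₀ ⁆) i ≡ true
    rest {i} Ri ne = ∖-intro R ⁅ i₀ ⁆ i Ri ne
    avoids : ∀ {i} (Ri : R i ≡ true) (ne : ⁅ i₀ ⁆ i ≡ false) → j₀ ≡ f′ i → ⊥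
    avoids {i} Ri ne refl = ∖-elim C ⁅ j₀ ⁆ j₀ (proj₂ (ok′ i (rest Ri ne))) (does-refl j₀)
    ok : ∀ i → R i ≡ true → (G i (f i) ≡ true) × (C (f i) ≡ true)
    ok i Ri with ⁅ i₀ ⁆ i in e
    ... | false = proj₁ (ok′ i (rest Ri e)) , ∖-left C ⁅ j₀ ⁆ _ (proj₂ (ok′ i (rest Ri e)))
    ... | true with does-true (i₀ ≟ i) e
    ...   | refl = ∧-left (G i₀ j₀) edge , ∧-right (G i₀ j₀) edge
    inj : ∀ i i′ → R i ≡ true → R i′ ≡ true → f i ≡ f i′ → i ≡ i′
    inj i i′ Ri Ri′ e with ⁅ i₀ ⁆ i in ei | ⁅ i₀ ⁆ i′ in ei′
    ... | true  | true  = trans (sym (does-true (i₀ ≟ i) ei)) (does-true (i₀ ≟ i′) ei′)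
    ... | false | false = inj′ i i′ (rest Ri ei) (rest Ri′ ei′) e
    ... | true  | false = ⊥-elim (avoids Ri′ ei′ e)
    ... | false | true  = ⊥-elim (avoids Ri ei (sym e))

  -- A violator after removing an edge i₀j₀ is a tight set before: it loses at most j₀.
  violator⇒tight : ∀ {R C} i₀ j₀ → R i₀ ≡ true →
    Violator (R ∖ ⁅ i₀ ⁆) (C ∖ ⁅ j₀ ⁆) → Σ (BSet s) (Tight R C)
  violator⇒tight {R} {C} i₀ j₀ Ri₀ (T , T⊆ , few) =
    T , (λ i e → ∖-left R ⁅ i₀ ⁆ i (T⊆ i e)) , ≤-trans (s≤s z≤n) few , proper , bound
    where
    open ≤-Reasoning
    proper : card T < card R
    proper = begin-strict
      card T               ≤⟨ card-mono {P = T} {Q = R ∖ ⁅ i₀ ⁆} T⊆ ⟩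
      card (R ∖ ⁅ i₀ ⁆)    <⟨ n<1+n _ ⟩
      suc (card (R ∖ ⁅ i₀ ⁆)) ≡⟨ card-remove {R = R} Ri₀ ⟨
      card R               ∎
    covered : ∀ j → Nbr T C j ≡ true → ⁅ j₀ ⁆ j ≡ false → Nbr T (C ∖ ⁅ j₀ ⁆) j ≡ true
    covered j e ne = ∧-intro (∖-intro C ⁅ j₀ ⁆ j (∧-left (C j) e) ne) (∧-right (C j) e)
    bound : card (Nbr T C) ≤ card T
    bound = begin
      card (Nbr T C)                               ≤⟨ card-cover _ _ _ covered ⟩
      card (Nbr T (C ∖ ⁅ j₀ ⁆)) + card ⁅ j₀ ⁆      ≡⟨ cong (card (Nbr T (C ∖ ⁅ j₀ ⁆)) +_) (card-⁅⁆ j₀) ⟩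
      card (Nbr T (C ∖ ⁅ j₀ ⁆)) + 1                ≡⟨ +-comm _ 1 ⟩
      suc (card (Nbr T (C ∖ ⁅ j₀ ⁆)))              ≤⟨ few ⟩
      card T                                       ∎

  -- Hall's theorem, by induction on |R|: either split along a tight set, or
  -- (when every proper subset has a surplus) match one edge and recurse.
  hall : ∀ N R C → card R ≤ N → Matching R C ⊎ Violator R C
  hall zero R C small =
    inj₁ (emptyMatching C (λ i Ri → contradiction (≤-trans (card-pos R i Ri) small) λ ()))
  hall (suc N) R C small with anySubset? (λ V → tight? R C (lookup V))
  ... | yes (V , S⊆R , nonempty , proper , few) =
    combine S⊆R few (hall N S (Nbr S C) (≤-pred (≤-trans proper small)))
                    (hall N (R ∖ S) (C ∖ Nbr S C) rest-small)
    where
    S = lookup V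
    rest-small : card (R ∖ S) ≤ N
    rest-small = ≤-pred (≤-trans (+-monoˡ-≤ (card (R ∖ S)) nonempty)
                                 (≤-trans (≤-reflexive (sym (card-∖ R S S⊆R))) small))
  ... | no noTight with any? (λ i → R i Boolₚ.≟ true)
  ...   | no empty = inj₁ (emptyMatching C (λ i Ri → empty (i , Ri)))
  ...   | yes (i₀ , Ri₀) with any? (λ j → G i₀ j ∧ C j Boolₚ.≟ true)
  ...     | no isolated = inj₂ (isolatedRow i₀ Ri₀ isolated)
  ...     | yes (j₀ , edge)
            with hall N (R ∖ ⁅ i₀ ⁆) (C ∖ ⁅ j₀ ⁆) (≤-pred (subst (_≤ suc N) (card-remove {R = R} Ri₀) small))
  ...       | inj₁ m = inj₁ (extend i₀ j₀ edge m)
  ...       | inj₂ v with violator⇒tight i₀ j₀ Ri₀ v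
  ...         | T , tight =
    ⊥-elim (noTight (tabulate T , tight-resp R C (λ i → sym (lookup∘tabulate T i)) tight))

argmin : ∀ {n} → Fin n → (f : Fin n → ℕ) → ∃ λ i → ∀ j → f i ≤ f j
argmin {suc zero}    _ f = Fin.zero , λ { Fin.zero → ≤-refl }
argmin {suc (suc n)} _ f with argmin Fin.zero (λ j → f (Fin.suc j))
... | i , min with f Fin.zero ≤? f (Fin.suc i)
...   | yes f0≤ = Fin.zero  , λ { Fin.zero → ≤-refl ; (Fin.suc j) → ≤-trans f0≤ (min j) }
...   | no  f0≰ = Fin.suc i , λ { Fin.zero → <⇒≤ (≰⇒> f0≰) ; (Fin.suc j) → min j }

injective⇒onto : ∀ {t} (f : Fin t → Fin t) → Injective _≡_ _≡_ f → ∀ j → ∃ λ i → f i ≡ j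
injective⇒onto {suc t} f inj j with any? (λ i → f i ≟ j)
... | yes hit = hit
... | no miss with pigeonhole (n<1+n t) (λ i → punchOut {i = j} {j = f i} (λ e → miss (i , sym e)))
...   | i₁ , i₂ , i₁<i₂ , same =
  ⊥-elim (<⇒≢ᶠ i₁<i₂ (inj (punchOut-injective (λ e → miss (i₁ , sym e)) (λ e → miss (i₂ , sym e)) same)))

-- Reindexing a sum along an injective endomap of Fin t (a permutation) does not decrease it:
-- every v j occurs as some v (f i).
sumFin-reindex : ∀ t (f : Fin t → Fin t) → Injective _≡_ _≡_ f → (v : Fin t → ℕ) →
  sumFin t v ≤ sumFin t (λ i → v (f i))
sumFin-reindex t f inj v = begin
  sumFin t v                                                ≤⟨ sumFin-mono t hit ⟩
  sumFin t (λ j → sumFin t (λ i → ind (⁅ f i ⁆ j) * v j))   ≡⟨ sumFin-swap t t (λ i j → ind (⁅ f i ⁆ j) * v j) ⟨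
  sumFin t (λ i → sumFin t (λ j → ind (⁅ f i ⁆ j) * v j))   ≡⟨ sumFin-cong t (λ i → sumFin-select t (f i) v) ⟩
  sumFin t (λ i → v (f i))                                  ∎
  where
  open ≤-Reasoning
  hit : ∀ j → v j ≤ sumFin t (λ i → ind (⁅ f i ⁆ j) * v j)
  hit j with injective⇒onto f inj j
  ... | i , refl = ≤-trans (≤-reflexive (sym self)) (term≤sumFin t (λ i′ → ind (⁅ f i′ ⁆ (f i)) * v (f i)) i)
    where
    self : ind (⁅ f i ⁆ (f i)) * v (f i) ≡ v (f i)
    self = trans (cong (λ b → ind b * v (f i)) (does-refl (f i))) (+-identityʳ _)

-- Egerváry's theorem, in the direction needed: an injective assignment of rows to
-- columns whose weight is at least the cost Σ u + Σ v of some cover of W.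
record OptimalPair (s t : ℕ) (W : Matrix s t) : Set where
  field
    match       : Fin s → Fin t
    injective   : Injective _≡_ _≡_ match
    rowPot      : Fin s → ℕ
    colPot      : Fin t → ℕ
    covers      : ∀ i j → W i j ≤ rowPot i + colPot j
    cost≤weight : sumFin s rowPot + sumFin t colPot ≤ sumFin s (λ i → W i (match i))

lower-cover : ∀ w u v a b → w + (a + b) ≤ u + v → b ≤ u → a ≤ v → w ≤ (u ∸ b) + (v ∸ a)
lower-cover w u v a b shifted b≤u a≤v = +-cancelʳ-≤ (a + b) w ((u ∸ b) + (v ∸ a)) (begin
  w + (a + b)                 ≤⟨ shifted ⟩
  u + v                       ≡⟨ cong₂ _+_ (m∸n+n≡m b≤u) (m∸n+n≡m a≤v) ⟨
  (u ∸ b + b) + (v ∸ a + a)   ≡⟨ regroup (u ∸ b) (v ∸ a) a b ⟩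
  (u ∸ b) + (v ∸ a) + (a + b) ∎)
  where
  open ≤-Reasoning
  regroup : ∀ x y a b → (x + b) + (y + a) ≡ x + y + (a + b)
  regroup = solve-∀

lower-cost : ∀ t (u v : Fin t → ℕ) w a b → (∀ i → b ≤ u i) → (∀ j → a ≤ v j) →
  sumFin t u + sumFin t v ≤ w + t * (a + b) → sumFin t (λ i → u i ∸ b) + sumFin t (λ j → v j ∸ a) ≤ w
lower-cost t u v w a b b≤u a≤v shifted = +-cancelʳ-≤ (t * (a + b)) _ w (begin
  U + V + t * (a + b)           ≡⟨ regroup U V t a b ⟩
  (t * b + U) + (t * a + V)     ≡⟨ cong₂ _+_ (sumFin-excess t u b b≤u) (sumFin-excess t v a a≤v) ⟨
  sumFin t u + sumFin t v       ≤⟨ shifted ⟩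
  w + t * (a + b)               ∎)
  where
  open ≤-Reasoning
  U = sumFin t (λ i → u i ∸ b)
  V = sumFin t (λ j → v j ∸ a)
  regroup : ∀ U V t a b → U + V + t * (a + b) ≡ (t * b + U) + (t * a + V)
  regroup = solve-∀

-- The Hungarian method on a square matrix, with covers shifted by K so that all
-- potentials only ever increase.
module Hungarian {t : ℕ} (W : Matrix t t) (default : Fin t) where

  Covers : (Fin t → ℕ) → (Fin t → ℕ) → ℕ → Set
  Covers u v K = ∀ i j → W i j + K ≤ u i + v j

  cost : (Fin t → ℕ) → (Fin t → ℕ) → ℕ
  cost u v = sumFin t u + sumFin t v

  tightEdge : (Fin t → ℕ) → (Fin t → ℕ) → ℕ → Fin t → Fin t → Bool
  tightEdge u v K i j = does (u i + v j ℕ.≟ W i j + K)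

  cost-lower : ∀ {u v K} → Covers u v K → t * K ≤ cost u v
  cost-lower {u} {v} {K} cover = begin
    t * K                        ≡⟨ sumFin-const t K ⟨
    sumFin t (λ _ → K)           ≤⟨ sumFin-mono t (λ i → m≤n+m K (W i i)) ⟩
    sumFin t (λ i → W i i + K)   ≤⟨ sumFin-mono t (λ i → cover i i) ⟩
    sumFin t (λ i → u i + v i)   ≡⟨ sumFin-+ t u v ⟩
    cost u v                     ∎
    where open ≤-Reasoning

  record Solution : Set where
    field
      u v       : Fin t → ℕ
      K         : ℕ
      cover     : Covers u v K
      match     : Fin t → Fin t
      injective : Injective _≡_ _≡_ match
      tight     : ∀ i → u i + v (match i) ≡ W i (match i) + K

  Raised : (Fin t → ℕ) → (Fin t → ℕ) → ℕ → Set
  Raised u v K = Σ (Fin t → ℕ) λ u′ → Σ (Fin t → ℕ) λ v′ →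
    Covers u′ v′ (suc K) × suc (cost u′ v′) ≤ cost u v + t

  -- One Hungarian step. For a Hall violator S of the tight graph, raising u off S and v
  -- on N(S) by one gives a (K+1)-cover; the cost grows by |¬S| + |N(S)| < |¬S| + |S| = t.
  raise : ∀ {u v K} → Covers u v K → Hall.Violator (tightEdge u v K) default full full → Raised u v K
  raise {u} {v} {K} cover (S , _ , few) = u′ , v′ , cover′ , cheaper
    where
    N = Hall.Nbr (tightEdge u v K) default S full
    u′ v′ : Fin t → ℕ
    u′ i = ind (not (S i)) + u i
    v′ j = ind (N j) + v j
    tight⇒N : ∀ {i j} → S i ≡ true → W i j + K ≡ u i + v j → N j ≡ true
    tight⇒N {i} {j} Si eq = anyB-intro _ i (∧-intro Si (dec-true (u i + v j ℕ.≟ W i j + K) (sym eq)))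
    cover′ : Covers u′ v′ (suc K)
    cover′ i j rewrite +-suc (W i j) K with S i in Si | m≤n⇒m<n∨m≡n (cover i j)
    ... | false | _ = s≤s (≤-trans (cover i j) (+-monoʳ-≤ (u i) (m≤n+m (v j) (ind (N j)))))
    ... | true | inj₁ slack = ≤-trans slack (+-monoʳ-≤ (u i) (m≤n+m (v j) (ind (N j))))
    ... | true | inj₂ eq rewrite tight⇒N Si eq = ≤-reflexive (trans (cong suc eq) (sym (+-suc (u i) (v j))))
    cheaper : suc (cost u′ v′) ≤ cost u v + t
    cheaper = begin
      suc (cost u′ v′)
        ≡⟨ cong suc (cong₂ _+_ (sumFin-+ t _ u) (sumFin-+ t _ v)) ⟩
      suc ((card (full ∖ S) + sumFin t u) + (card N + sumFin t v))
        ≡⟨ shuffle (card (full ∖ S)) (sumFin t u) (card N) (sumFin t v) ⟩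
      cost u v + (suc (card N) + card (full ∖ S))
        ≤⟨ +-monoʳ-≤ (cost u v) (+-monoˡ-≤ (card (full ∖ S)) few) ⟩
      cost u v + (card S + card (full ∖ S))
        ≡⟨ cong (cost u v +_) (trans (sym (card-∖ full S (λ _ _ → refl))) (card-full t)) ⟩
      cost u v + t ∎
      where
      open ≤-Reasoning
      shuffle : ∀ a U n V → suc ((a + U) + (n + V)) ≡ (U + V) + (suc n + a)
      shuffle = solve-∀

  budget : ∀ {c c′} B K → c ≤ B + t * K → suc c′ ≤ c + t → suc c′ ≤ B + t * suc K
  budget {c} {c′} B K bounded cheaper = begin
    suc c′          ≤⟨ cheaper ⟩
    c + t           ≤⟨ +-monoˡ-≤ t bounded ⟩
    B + t * K + t   ≡⟨ +-assoc B (t * K) t ⟩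
    B + (t * K + t) ≡⟨ cong (B +_) (trans (+-comm (t * K) t) (sym (*-suc t K))) ⟩
    B + t * suc K   ∎
    where open ≤-Reasoning

  -- Iterate until the tight graph has a perfect matching (Hall). Since cost u v − t K
  -- drops at every step and stays nonnegative (cost-lower), B steps suffice.
  search : ∀ B {u v K} → Covers u v K → cost u v ≤ B + t * K → Solution
  descend : ∀ B {u v K} → cost u v ≤ B + t * K → Raised u v K → Solution

  search B {u} {v} {K} cover bounded
    with Hall.hall (tightEdge u v K) default t full full (≤-reflexive (card-full t))
  ... | inj₂ violator = descend B bounded (raise cover violator)
  ... | inj₁ (f , ok , inj) = record
    { u = u ; v = v ; K = K ; cover = cover ; match = f
    ; injective = λ {i} {i′} → inj i i′ refl refl
    ; tight = λ i → does-true (u i + v (f i) ℕ.≟ W i (f i) + K) (proj₁ (ok i refl))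
    }

  descend zero    {K = K} bounded (u′ , v′ , cover′ , cheaper) =
    ⊥-elim (<-irrefl refl (≤-trans (budget 0 K bounded cheaper) (cost-lower cover′)))
  descend (suc B) {K = K} bounded (u′ , v′ , cover′ , cheaper) =
    search B cover′ (≤-pred (budget (suc B) K bounded cheaper))

  -- The shift K splits as a + b with a ≤ v and b ≤ u pointwise: if K exceeds the
  -- minimum v j₀ of v, the rest K − v j₀ is below every u i because W i j₀ + K ≤ u i + v j₀.
  splitShift : ∀ {u v K} → Covers u v K →
    Σ ℕ λ a → Σ ℕ λ b → a + b ≡ K × (∀ j → a ≤ v j) × (∀ i → b ≤ u i)
  splitShift {u} {v} {K} cover with argmin default v
  ... | j₀ , v-min with K ≤? v j₀
  ...   | yes K≤ = K , 0 , +-identityʳ K , (λ j → ≤-trans K≤ (v-min j)) , (λ _ → z≤n)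
  ...   | no  K≰ = v j₀ , K ∸ v j₀ , m+[n∸m]≡n (<⇒≤ (≰⇒> K≰)) , v-min , rest≤u
    where
    rest≤u : ∀ i → K ∸ v j₀ ≤ u i
    rest≤u i = m≤n+o⇒m∸n≤o K (v j₀)
      (≤-trans (m≤n+m K (W i j₀)) (≤-trans (cover i j₀) (≤-reflexive (+-comm (u i) (v j₀)))))

  -- For a solution, Σ u + Σ v = Σ_i (u i + v (match i)) = weight of match + t K,
  -- since match permutes the columns.
  solution-cost : (sol : Solution) → let open Solution sol in
    cost u v ≤ sumFin t (λ i → W i (match i)) + t * K
  solution-cost sol = begin
    sumFin t u + sumFin t v                           ≤⟨ +-monoʳ-≤ (sumFin t u) (sumFin-reindex t match injective v) ⟩
    sumFin t u + sumFin t (λ i → v (match i))         ≡⟨ sumFin-+ t u _ ⟨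
    sumFin t (λ i → u i + v (match i))                ≡⟨ sumFin-cong t tight ⟩
    sumFin t (λ i → W i (match i) + K)                ≡⟨ sumFin-+ t _ _ ⟩
    sumFin t (λ i → W i (match i)) + sumFin t (λ _ → K) ≡⟨ cong (sumFin t (λ i → W i (match i)) +_) (sumFin-const t K) ⟩
    sumFin t (λ i → W i (match i)) + t * K            ∎
    where
    open Solution sol
    open ≤-Reasoning

  optimal : Solution → OptimalPair t t W
  optimal sol with splitShift (Solution.cover sol)
  ... | a , b , a+b≡K , a≤v , b≤u = record
    { match = match ; injective = injective
    ; rowPot = λ i → u i ∸ b ; colPot = λ j → v j ∸ a
    ; covers = λ i j → lower-cover (W i j) (u i) (v j) a b
                         (shifted (λ K → W i j + K ≤ u i + v j) (cover i j)) (b≤u i) (a≤v j)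
    ; cost≤weight = lower-cost t u v _ a b b≤u a≤v (shifted (λ K → cost u v ≤ matched + t * K) (solution-cost sol))
    }
    where
    open Solution sol
    matched : ℕ
    matched = sumFin t (λ i → W i (match i))
    shifted : (P : ℕ → Set) → P K → P (a + b)
    shifted P = subst P (sym a+b≡K)

egervary-square : ∀ t (W : Matrix t t) → OptimalPair t t W
egervary-square zero    W = record
  { match = λ () ; injective = λ { {()} } ; rowPot = λ () ; colPot = λ ()
  ; covers = λ () ; cost≤weight = z≤n }
egervary-square (suc t) W = optimal (search (cost u₀ v₀) {u₀} {v₀} cover₀ (m≤m+n _ _))
  where
  open Hungarian W Fin.zero
  u₀ v₀ : Fin (suc t) → ℕ
  u₀ i = sumFin (suc t) (W i)
  v₀ _ = 0
  cover₀ : Covers u₀ v₀ 0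
  cover₀ i j rewrite +-identityʳ (W i j) | +-identityʳ (u₀ i) = term≤sumFin (suc t) (W i) j

pad : ∀ s e → Matrix s (s + e) → Matrix (s + e) (s + e)
pad s e W i j = [ (λ i′ → W i′ j) , (λ _ → 0) ]′ (splitAt s i)

-- Egerváry's theorem for s × t matrices with s ≤ t, by restricting an optimal pair of
-- the padded matrix to the original rows (the padding rows contribute weight 0).
egervary : ∀ {s t} → s ≤ t → (W : Matrix s t) → OptimalPair s t W
egervary {s} s≤t W with m≤n⇒∃[o]m+o≡n s≤t
... | e , refl = record
  { match = λ i → match (i ↑ˡ e)
  ; injective = λ same → ↑ˡ-injective e _ _ (injective same)
  ; rowPot = λ i → rowPot (i ↑ˡ e)
  ; colPot = colPot
  ; covers = λ i j → subst (_≤ rowPot (i ↑ˡ e) + colPot j) (pad-top i j) (covers (i ↑ˡ e) j)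
  ; cost≤weight = begin
      sumFin s (λ i → rowPot (i ↑ˡ e)) + sumFin (s + e) colPot
        ≤⟨ +-monoˡ-≤ (sumFin (s + e) colPot) (≤-trans (m≤m+n _ _) (≤-reflexive (sym (sumFin-split s e rowPot)))) ⟩
      sumFin (s + e) rowPot + sumFin (s + e) colPot
        ≤⟨ cost≤weight ⟩
      sumFin (s + e) (λ i → pad s e W i (match i))
        ≡⟨ sumFin-split s e _ ⟩
      sumFin s (λ i → pad s e W (i ↑ˡ e) (match (i ↑ˡ e))) + sumFin e (λ i → pad s e W (s ↑ʳ i) (match (s ↑ʳ i)))
        ≡⟨ cong₂ _+_ (sumFin-cong s (λ i → pad-top i _)) (trans (sumFin-cong e (λ i → pad-bottom i _)) (sumFin-zero e)) ⟩
      sumFin s (λ i → W i (match (i ↑ˡ e))) + 0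
        ≡⟨ +-identityʳ _ ⟩
      sumFin s (λ i → W i (match (i ↑ˡ e))) ∎
  }
  where
  open OptimalPair (egervary-square (s + e) (pad s e W))
  open ≤-Reasoning
  pad-top : ∀ i j → pad s e W (i ↑ˡ e) j ≡ W i j
  pad-top i j rewrite splitAt-↑ˡ s i e = refl
  pad-bottom : ∀ i j → pad s e W (s ↑ʳ i) j ≡ 0
  pad-bottom i j rewrite splitAt-↑ʳ s e i = refl

rowSum≤ : ∀ {s t} (A : Matrix s t) (u : Fin s → ℕ) (v : Fin t → ℕ) →
  (∀ i j → A i j ≤ u i + v j) → ∀ i → rowSum A i ≤ t * u i + sumFin t v
rowSum≤ {t = t} A u v covers i = begin
  sumFin t (A i)                             ≤⟨ sumFin-mono t (covers i) ⟩
  sumFin t (λ j → u i + v j)                 ≡⟨ sumFin-+ t _ v ⟩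
  sumFin t (λ _ → u i) + sumFin t v          ≡⟨ cong (_+ sumFin t v) (sumFin-const t (u i)) ⟩
  t * u i + sumFin t v                       ∎
  where open ≤-Reasoning

colSum≤ : ∀ {s t} (A : Matrix s t) (u : Fin s → ℕ) (v : Fin t → ℕ) →
  (∀ i j → A i j ≤ u i + v j) → ∀ j → colSum A j ≤ sumFin s u + s * v j
colSum≤ {s = s} A u v covers j = begin
  sumFin s (λ i → A i j)                     ≤⟨ sumFin-mono s (λ i → covers i j) ⟩
  sumFin s (λ i → u i + v j)                 ≡⟨ sumFin-+ s u _ ⟩
  sumFin s u + sumFin s (λ _ → v j)          ≡⟨ cong (sumFin s u +_) (sumFin-const s (v j)) ⟩
  sumFin s u + s * v j                       ∎
  where open ≤-Reasoning

weighted-rows : ∀ {s t} (A : Matrix s t) (w : Fin s → ℕ) ρ → (∀ i → rowSum A i ≡ ρ) →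
  sumFin s (λ i → sumFin t (λ j → w i * A i j)) ≡ sumFin s w * ρ
weighted-rows {s} {t} A w ρ rows = begin
  sumFin s (λ i → sumFin t (λ j → w i * A i j)) ≡⟨ sumFin-cong s (λ i → sumFin-*ˡ t (w i) (A i)) ⟩
  sumFin s (λ i → w i * rowSum A i)             ≡⟨ sumFin-cong s (λ i → cong (w i *_) (rows i)) ⟩
  sumFin s (λ i → w i * ρ)                      ≡⟨ sumFin-*ʳ s w ρ ⟩
  sumFin s w * ρ                                ∎
  where open ≡-Reasoning

weighted-cols : ∀ {s t} (A : Matrix s t) (w : Fin t → ℕ) γ → (∀ j → colSum A j ≡ γ) →
  sumFin s (λ i → sumFin t (λ j → w j * A i j)) ≡ sumFin t w * γ
weighted-cols {s} {t} A w γ cols = begin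
  sumFin s (λ i → sumFin t (λ j → w j * A i j)) ≡⟨ sumFin-swap s t (λ i j → w j * A i j) ⟩
  sumFin t (λ j → sumFin s (λ i → w j * A i j)) ≡⟨ sumFin-cong t (λ j → sumFin-*ˡ s (w j) (λ i → A i j)) ⟩
  sumFin t (λ j → w j * colSum A j)             ≡⟨ sumFin-cong t (λ j → cong (w j *_) (cols j)) ⟩
  sumFin t (λ j → w j * γ)                      ≡⟨ sumFin-*ʳ t w γ ⟩
  sumFin t w * γ                                ∎
  where open ≡-Reasoning

-- Double counting: in a matrix with row sums ρ and column sums γ whose block e × f has
-- entries ≤ c, the columns of f carry at most the block plus the rows outside e, so
-- |e| ρ + |f| γ ≤ s ρ + |e| |f| c.
blockCount : ∀ {s t} (A : Matrix s t) (e : BSet s) (f : BSet t) c ρ γ →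
  (∀ i → rowSum A i ≡ ρ) → (∀ j → colSum A j ≡ γ) →
  (∀ i j → e i ≡ true → f j ≡ true → A i j ≤ c) →
  card e * ρ + card f * γ ≤ s * ρ + card e * (card f * c)
blockCount {s} {t} A e f c ρ γ rows cols block = begin
  card e * ρ + card f * γ
    ≡⟨ cong (card e * ρ +_) (weighted-cols A (λ j → ind (f j)) γ cols) ⟨
  card e * ρ + sumFin s (λ i → sumFin t (λ j → ind (f j) * A i j))
    ≤⟨ +-monoʳ-≤ (card e * ρ) (sumFin-mono s (λ i → sumFin-mono t (λ j → split i j))) ⟩
  card e * ρ + sumFin s (λ i → sumFin t (λ j → ind (e i) * (ind (f j) * c) + ind (not (e i)) * A i j))
    ≡⟨ cong (card e * ρ +_) (trans (sumFin-cong s (λ i → sumFin-+ t _ _)) (sumFin-+ s _ _)) ⟩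
  card e * ρ + (sumFin s (λ i → sumFin t (λ j → ind (e i) * (ind (f j) * c)))
                + sumFin s (λ i → sumFin t (λ j → ind (not (e i)) * A i j)))
    ≡⟨ cong (λ z → card e * ρ + z) (cong₂ _+_ (weighted-rows (λ _ j → ind (f j) * c) (λ i → ind (e i)) _ (λ _ → sumFin-*ʳ t _ c))
                                               (weighted-rows A (λ i → ind (not (e i))) ρ rows)) ⟩
  card e * ρ + (card e * (card f * c) + card (full ∖ e) * ρ)
    ≡⟨ regroup (card e) (card (full ∖ e)) ρ (card e * (card f * c)) ⟩
  (card e + card (full ∖ e)) * ρ + card e * (card f * c)
    ≡⟨ cong (λ z → z * ρ + card e * (card f * c)) (trans (sym (card-∖ full e (λ _ _ → refl))) (card-full s)) ⟩
  s * ρ + card e * (card f * c) ∎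
  where
  open ≤-Reasoning
  regroup : ∀ E F ρ B → E * ρ + (B + F * ρ) ≡ (E + F) * ρ + B
  regroup = solve-∀
  split : ∀ i j → ind (f j) * A i j ≤ ind (e i) * (ind (f j) * c) + ind (not (e i)) * A i j
  split i j with e i in ei | f j in fj
  ... | true  | true  = begin
    1 * A i j             ≡⟨ *-identityˡ (A i j) ⟩
    A i j                 ≤⟨ block i j ei fj ⟩
    c                     ≡⟨ unit c ⟨
    1 * (1 * c) + 0 * A i j ∎
    where
    unit : ∀ c → 1 * (1 * c) + 0 ≡ c
    unit = solve-∀
  ... | true  | false = z≤n
  ... | false | true  = ≤-refl
  ... | false | false = z≤n

card-≠≤excess : ∀ n (u : Fin n → ℕ) a → (∀ i → a ≤ u i) →
  card (λ i → not (does (u i ℕ.≟ a))) ≤ sumFin n (λ i → u i ∸ a)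
card-≠≤excess n u a a≤u = sumFin-mono n pointwise
  where
  pointwise : ∀ i → ind (not (does (u i ℕ.≟ a))) ≤ u i ∸ a
  pointwise i with does (u i ℕ.≟ a) in u≟a
  ... | true  = z≤n
  ... | false = m<n⇒0<n∸m (≤∧≢⇒< (a≤u i) (λ e → does-false (u i ℕ.≟ a) u≟a (sym e)))

block-identity : ∀ k l n q r R ρ C γ → n * k ≡ R + ρ → n * l ≡ C + γ →
  (q * ρ * γ + r * (ρ * l + γ * k)) + (R * ((q * n + r) * l) + C * ((q * n + r) * k))
  ≡ k * l * n * r + ((n * k) * ((q * n + r) * l) + R * (C * q))
block-identity k l n q r R ρ C γ nk≡ nl≡ = begin
  (q * ρ * γ + r * (ρ * l + γ * k)) + (R * ((q * n + r) * l) + C * ((q * n + r) * k))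
    ≡⟨ expand k l n q r R ρ C γ ⟩
  g (n * k) (n * l) ≡⟨ cong₂ g nk≡ nl≡ ⟩
  g (R + ρ) (C + γ) ≡⟨ substituted k l q r R ρ C γ ⟩
  h (R + ρ) (C + γ) ≡⟨ cong₂ h nk≡ nl≡ ⟨
  h (n * k) (n * l) ≡⟨ collect k l n q r R C ⟩
  k * l * n * r + ((n * k) * ((q * n + r) * l) + R * (C * q)) ∎
  where
  open ≡-Reasoning
  g h : ℕ → ℕ → ℕ
  g P Q = q * ρ * γ + r * ρ * l + r * γ * k + q * R * Q + r * R * l + q * C * P + r * C * k
  h P Q = r * k * Q + q * P * Q + r * l * P + q * R * C
  expand : ∀ k l n q r R ρ C γ →
    (q * ρ * γ + r * (ρ * l + γ * k)) + (R * ((q * n + r) * l) + C * ((q * n + r) * k))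
    ≡ q * ρ * γ + r * ρ * l + r * γ * k + q * R * (n * l) + r * R * l + q * C * (n * k) + r * C * k
  expand = solve-∀
  substituted : ∀ k l q r R ρ C γ →
    q * ρ * γ + r * ρ * l + r * γ * k + q * R * (C + γ) + r * R * l + q * C * (R + ρ) + r * C * k
    ≡ r * k * (C + γ) + q * (R + ρ) * (C + γ) + r * l * (R + ρ) + q * R * C
  substituted = solve-∀
  collect : ∀ k l n q r R C →
    r * k * (n * l) + q * (n * k) * (n * l) + r * l * (n * k) + q * R * C
    ≡ k * l * n * r + ((n * k) * ((q * n + r) * l) + R * (C * q))
  collect = solve-∀

-- The counting inequality for the block where both potentials are minimal, restated
-- through block-identity: it is exactly the product condition of admissibility for the
-- numbers ρ, γ of rows and columns outside the block.
block⇒product : ∀ k l n q r R ρ C γ → n * k ≡ R + ρ → n * l ≡ C + γ →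
  R * ((q * n + r) * l) + C * ((q * n + r) * k) ≤ (n * k) * ((q * n + r) * l) + R * (C * q) →
  k * l * n * r ≤ q * ρ * γ + r * (ρ * l + γ * k)
block⇒product k l n q r R ρ C γ nk≡ nl≡ count = +-cancelʳ-≤ P (k * l * n * r) _ (begin
  k * l * n * r + P                                             ≤⟨ +-monoʳ-≤ (k * l * n * r) count ⟩
  k * l * n * r + ((n * k) * ((q * n + r) * l) + R * (C * q))   ≡⟨ block-identity k l n q r R ρ C γ nk≡ nl≡ ⟨
  (q * ρ * γ + r * (ρ * l + γ * k)) + P                         ∎)
  where
  open ≤-Reasoning
  P = R * ((q * n + r) * l) + C * ((q * n + r) * k)

-- Below q the column excess Y pays for a full extra layer T ≥ S; at q the excesses
-- (X, Y) form an admissible pair.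
minimum-bound : ∀ S T q c X Y x y → S ≤ T → q * S ≤ S * c + X → q * T ≤ T * c + Y →
  (c ≡ q → x + y ≤ X + Y) → (S * (q + 1)) ⊓ (S * q + x + y) ≤ S * c + X + Y
minimum-bound S T q c X Y x y S≤T colBound rowBound atq with <-cmp c q
... | tri> _ _ q<c = ≤-trans (m⊓n≤m _ _) (begin
  S * (q + 1)     ≤⟨ *-monoʳ-≤ S (≤-trans (≤-reflexive (+-comm q 1)) q<c) ⟩
  S * c           ≤⟨ m≤m+n (S * c) X ⟩
  S * c + X       ≤⟨ m≤m+n (S * c + X) Y ⟩
  S * c + X + Y   ∎)
  where open ≤-Reasoning
... | tri≈ _ refl _ = ≤-trans (m⊓n≤n _ _) (begin
  S * q + x + y   ≡⟨ +-assoc (S * q) x y ⟩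
  S * q + (x + y) ≤⟨ +-monoʳ-≤ (S * q) (atq refl) ⟩
  S * q + (X + Y) ≡⟨ +-assoc (S * q) X Y ⟨
  S * q + X + Y   ∎)
  where open ≤-Reasoning
... | tri< c<q _ _ = ≤-trans (m⊓n≤m _ _) (begin
  S * (q + 1)     ≡⟨ *-suc′ S q ⟩
  S * q + S       ≤⟨ +-mono-≤ (≤-trans (≤-reflexive (*-comm S q)) colBound) (≤-trans S≤T T≤Y) ⟩
  S * c + X + Y   ∎)
  where
  open ≤-Reasoning
  *-suc′ : ∀ S q → S * (q + 1) ≡ S * q + S
  *-suc′ = solve-∀
  T≤Y : T ≤ Y
  T≤Y = +-cancelˡ-≤ (T * c) T Y (begin
    T * c + T      ≡⟨ *-suc′ T c ⟨
    T * (c + 1)    ≤⟨ *-monoʳ-≤ T (≤-trans (≤-reflexive (+-comm c 1)) c<q) ⟩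
    T * q          ≡⟨ *-comm T q ⟩
    q * T          ≤⟨ rowBound ⟩
    T * c + Y      ∎)

module CoverBound {k l n q r : ℕ} (A : Matrix (n * k) (n * l))
  (rows : ∀ i → rowSum A i ≡ (q * n + r) * l) (cols : ∀ j → colSum A j ≡ (q * n + r) * k)
  (u : Fin (n * k) → ℕ) (v : Fin (n * l) → ℕ) (covers : ∀ i j → A i j ≤ u i + v j)
  (S≤T : n * k ≤ n * l) (some-row : Fin (n * k)) (some-col : Fin (n * l)) where

  private
    S T m : ℕ
    S = n * k
    T = n * l
    m = q * n + r

  a b X Y : ℕ
  a = u (proj₁ (argmin some-row u))
  b = v (proj₁ (argmin some-col v))
  X = sumFin S (λ i → u i ∸ a)
  Y = sumFin T (λ j → v j ∸ b)

  a≤u : ∀ i → a ≤ u i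
  a≤u = proj₂ (argmin some-row u)

  b≤v : ∀ j → b ≤ v j
  b≤v = proj₂ (argmin some-col v)

  colBound : q * S + r * k ≤ S * (a + b) + X
  colBound = begin
    q * S + r * k                ≡⟨ distrib q n r k ⟨
    m * k                        ≡⟨ cols _ ⟨
    colSum A _                   ≤⟨ colSum≤ A u v covers (proj₁ (argmin some-col v)) ⟩
    sumFin S u + S * b           ≡⟨ cong (_+ S * b) (sumFin-excess S u a a≤u) ⟩
    (S * a + X) + S * b          ≡⟨ regroup S a b X ⟩
    S * (a + b) + X              ∎
    where
    open ≤-Reasoning
    distrib : ∀ q n r k → (q * n + r) * k ≡ q * (n * k) + r * k
    distrib = solve-∀
    regroup : ∀ S a b X → (S * a + X) + S * b ≡ S * (a + b) + X
    regroup = solve-∀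

  rowBound : q * T + r * l ≤ T * (a + b) + Y
  rowBound = begin
    q * T + r * l                ≡⟨ distrib q n r l ⟨
    m * l                        ≡⟨ rows _ ⟨
    rowSum A _                   ≤⟨ rowSum≤ A u v covers (proj₁ (argmin some-row u)) ⟩
    T * a + sumFin T v           ≡⟨ cong (T * a +_) (sumFin-excess T v b b≤v) ⟩
    T * a + (T * b + Y)          ≡⟨ regroup T a b Y ⟩
    T * (a + b) + Y              ∎
    where
    open ≤-Reasoning
    distrib : ∀ q n r l → (q * n + r) * l ≡ q * (n * l) + r * l
    distrib = solve-∀
    regroup : ∀ T a b Y → T * a + (T * b + Y) ≡ T * (a + b) + Y
    regroup = solve-∀

  total : S * (a + b) + X + Y ≤ sumFin S u + sumFin T v
  total = begin
    S * (a + b) + X + Y           ≡⟨ regroup S a b X Y ⟩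
    (S * a + X) + (S * b + Y)     ≤⟨ +-monoʳ-≤ (S * a + X) (+-monoˡ-≤ Y (*-monoˡ-≤ b S≤T)) ⟩
    (S * a + X) + (T * b + Y)     ≡⟨ cong₂ _+_ (sumFin-excess S u a a≤u) (sumFin-excess T v b b≤v) ⟨
    sumFin S u + sumFin T v       ∎
    where
    open ≤-Reasoning
    regroup : ∀ S a b X Y → S * (a + b) + X + Y ≡ (S * a + X) + (S * b + Y)
    regroup = solve-∀

  -- When a + b = q the excesses form an admissible pair: the linear conditions come from
  -- colBound and rowBound, the product condition from counting on the block of rows with
  -- u i = a and columns with v j = b, whose entries are at most a + b = q.
  admissible : a + b ≡ q → Admissible k l n q r X Y
  admissible a+b≡q = r*k≤X , r*l≤Y , ≤-trans key monotone
    where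
    r*k≤X : r * k ≤ X
    r*k≤X = +-cancelˡ-≤ (q * S) (r * k) X
      (≤-trans colBound (≤-reflexive (cong (_+ X) (trans (cong (S *_) a+b≡q) (*-comm S q)))))
    r*l≤Y : r * l ≤ Y
    r*l≤Y = +-cancelˡ-≤ (q * T) (r * l) Y
      (≤-trans rowBound (≤-reflexive (cong (_+ Y) (trans (cong (T *_) a+b≡q) (*-comm T q)))))
    e : BSet S
    e i = does (u i ℕ.≟ a)
    f : BSet T
    f j = does (v j ℕ.≟ b)
    block : ∀ i j → e i ≡ true → f j ≡ true → A i j ≤ q
    block i j ei fj = ≤-trans (covers i j)
      (≤-reflexive (trans (cong₂ _+_ (does-true (u i ℕ.≟ a) ei) (does-true (v j ℕ.≟ b) fj)) a+b≡q))
    partition : ∀ {N} (P : BSet N) → N ≡ card P + card (full ∖ P)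
    partition {N} P = trans (sym (card-full N)) (card-∖ full P (λ _ _ → refl))
    ρ γ : ℕ
    ρ = card (full ∖ e)
    γ = card (full ∖ f)
    key : k * l * n * r ≤ q * ρ * γ + r * (ρ * l + γ * k)
    key = block⇒product k l n q r (card e) ρ (card f) γ (partition e) (partition f)
            (blockCount A e f q (m * l) (m * k) rows cols block)
    monotone : q * ρ * γ + r * (ρ * l + γ * k) ≤ q * X * Y + r * (X * l + Y * k)
    monotone = +-mono-≤ (*-mono-≤ (*-monoʳ-≤ q ρ≤X) γ≤Y)
                        (*-monoʳ-≤ r (+-mono-≤ (*-monoˡ-≤ l ρ≤X) (*-monoˡ-≤ k γ≤Y)))
      where
      ρ≤X = card-≠≤excess S u a a≤u
      γ≤Y = card-≠≤excess T v b b≤v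

  lowerBound : ∀ {x y} → (∀ x′ y′ → Admissible k l n q r x′ y′ → x + y ≤ x′ + y′) →
    (n * k * (q + 1)) ⊓ (n * k * q + x + y) ≤ sumFin S u + sumFin T v
  lowerBound minimal = ≤-trans
    (minimum-bound S T q (a + b) X Y _ _ S≤T (≤-trans (m≤m+n _ _) colBound) (≤-trans (m≤m+n _ _) rowBound)
      (λ a+b≡q → minimal X Y (admissible a+b≡q)))
    total

mainTheorem2 : (k l n m q r x y : ℕ) →
    1 ≤ k → k ≤ l → gcd k l ≡ 1 → 1 ≤ n →
    m ≡ q * n + r → r < n →
    Admissible k l n q r x y →
    (∀ x′ y′ → Admissible k l n q r x′ y′ → x + y ≤ x′ + y′) →
    ∀ L → IsL k l m n L →
    (n * k * (q + 1)) ⊓ (n * k * q + x + y) ≤ L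
mainTheorem2 k l n m q r x y 1≤k k≤l _ 1≤n refl _ _ minimal L ((A , (rows , cols) , _ , maximal) , _) = begin
  (n * k * (q + 1)) ⊓ (n * k * q + x + y)         ≤⟨ lowerBound minimal ⟩
  sumFin (n * k) rowPot + sumFin (n * l) colPot   ≤⟨ cost≤weight ⟩
  weight A (rowsT nk≤nl match injective)          ≤⟨ maximal (rowsT nk≤nl match injective) ⟩
  L                                               ∎
  where
  open ≤-Reasoning
  nk≤nl : n * k ≤ n * l
  nk≤nl = *-monoʳ-≤ n k≤l
  1≤nk : 1 ≤ n * k
  1≤nk = *-mono-≤ 1≤n 1≤k
  open OptimalPair (egervary nk≤nl A)
  open CoverBound {k} {l} {n} {q} {r} A rows cols rowPot colPot covers nk≤nl
                  (fromℕ< 1≤nk) (fromℕ< (≤-trans 1≤nk nk≤nl))
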